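{- Let $(A,B,C,E)$ be an instance of $3$-DM with $A=\{a_1,\dots,a_n\}$, $B=\{b_1,\dots,b_n\}$, $C=\{c_1,\dots,c_n\}$, and for $x\in A\cup B\cup C$ let $E(x)=\{e\in E: x\in e\}$. Set $\alpha_A=12$, $\alpha_B=13$, $\alpha_C=22$, $\beta_A=14$, $\beta_B=15$, $\beta_C=18$. Construct an instance of scheduling with resource restrictions with resources $\mathcal{R}=\{A,B,C\}$ and machine set $\mathcal{M}=E$, where for each machine $e$ and $X\in\{A,B,C\}$ the capacity is $c_X(e)=i$ for the unique index $i$ with $x_i\in X\cap e$ (where $x_i$ is the element of $X$ with index $i$). For each $X\in\{A,B,C\}$ and each element $x_i\in X$, introduce one element job of size $\alpha_X$ and $|E(x_i)|-1$ dummy jobs of size $\beta_X$, each with demands $d_X=i$ and $d_Y=0$ for $Y\in\{A,B,C\}\setminus\{X\}$. Then the $3$-DM instance has a perfect matching if and only if the constructed instance has a schedule with makespan $47$.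
   Context: $3$-DM: given three disjoint sets $A,B,C$ with $|A|=|B|=|C|=n$ and a set $E$ of triplets $\{a,b,c\}$ with $a\in A$, $b\in B$, $c\in C$, decide whether there is $F\subseteq E$ (a perfect matching / 3D-matching) such that every $x\in A\cup B\cup C$ lies in exactly one triplet of $F$. It is assumed every element lies in at least one triplet of $E$. Scheduling with resource restrictions: job $j$ is eligible on machine $i$ iff $d_r(j)\le c_r(i)$ for every resource $r$; a schedule assigns every job to an eligible machine; the makespan is the maximum total processing time on a machine. -}

module Defs where

open import Data.Nat using (ℕ; zero; suc; _∸_; _≤_; _⊔_)
open import Data.Fin using (Fin; toℕ)
open import Data.Fin.Properties using (_≟_)
open import Data.List using (List; []; _∷_; map; filter; length; concatMap; foldr)
open import Data.Nat.ListAction using (sum)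
open import Data.List using () renaming (allFin to allFinL)
open import Data.Product using (Σ; ∃; _×_; _,_; proj₁; proj₂)
open import Relation.Binary.PropositionalEquality using (_≡_)

data Res : Set where
  rA rB rC : Res

allRes : List Res
allRes = rA ∷ rB ∷ rC ∷ []

-- Elements of each ground set X are indexed by Fin n (element x_i with
-- 1-based paper index i corresponds to Fin index i-1).
Triple : ℕ → Set
Triple n = Fin n × Fin n × Fin n

coord : ∀ {n} → Res → Triple n → Fin n
coord rA (a , b , c) = a
coord rB (a , b , c) = b
coord rC (a , b , c) = c

idx : ∀ {n} → Fin n → ℕ
idx i = suc (toℕ i)

-- A 3-DM instance: n, m triplets given by an injective map E : Fin m → Triple n
-- (injectivity = E is a set of triplets).

deg : ∀ {n m} → (Fin m → Triple n) → Res → Fin n → ℕ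
deg {m = m} E X i = length (filter (λ k → coord X (E k) ≟ i) (allFinL m))

IsPerfectMatching : ∀ {n m} → (Fin m → Triple n) → (Fin m → Set) → Set
IsPerfectMatching {n} {m} E F =
  (X : Res) (i : Fin n) →
    (Σ (Fin m) λ k → F k × coord X (E k) ≡ i)
    × ((k k′ : Fin m) → F k → F k′ → coord X (E k) ≡ i → coord X (E k′) ≡ i → k ≡ k′)

HasPerfectMatching : ∀ {n m} → (Fin m → Triple n) → Set₁
HasPerfectMatching {m = m} E = Σ (Fin m → Set) λ F → IsPerfectMatching E F

α β : Res → ℕ
α rA = 12
α rB = 13
α rC = 22
β rA = 14
β rB = 15
β rC = 18

data Kind (d : ℕ) : Set where
  elemJob : Kind d
  dummyJob : Fin (d ∸ 1) → Kind d

allKind : (d : ℕ) → List (Kind d)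
allKind d = elemJob ∷ map dummyJob (allFinL (d ∸ 1))

Job : ∀ {n m} → (Fin m → Triple n) → Set
Job {n} E = Σ Res λ X → Σ (Fin n) λ i → Kind (deg E X i)

allJobs : ∀ {n m} (E : Fin m → Triple n) → List (Job E)
allJobs {n} E =
  concatMap (λ X → concatMap (λ i → map (λ κ → X , i , κ) (allKind (deg E X i))) (allFinL n)) allRes

size : ∀ {n m} (E : Fin m → Triple n) → Job E → ℕ
size E (X , i , elemJob) = α X
size E (X , i , dummyJob _) = β X

sameRes : Res → Res → ℕ → ℕ
sameRes rA rA v = v
sameRes rB rB v = v
sameRes rC rC v = v
sameRes _ _ v = 0

demand : ∀ {n m} (E : Fin m → Triple n) → Job E → Res → ℕ
demand E (X , i , _) Y = sameRes X Y (idx i)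

capacity : ∀ {n m} (E : Fin m → Triple n) → Fin m → Res → ℕ
capacity E e Y = idx (coord Y (E e))

Eligible : ∀ {n m} (E : Fin m → Triple n) → Job E → Fin m → Set
Eligible E j e = (Y : Res) → demand E j Y ≤ capacity E e Y

Schedule : ∀ {n m} → (Fin m → Triple n) → Set
Schedule {m = m} E = Σ (Job E → Fin m) λ σ → (j : Job E) → Eligible E j (σ j)

load : ∀ {n m} (E : Fin m → Triple n) → Schedule E → Fin m → ℕ
load E (σ , _) e = sum (map (size E) (filter (λ j → σ j ≟ e) (allJobs E)))

makespan : ∀ {n m} (E : Fin m → Triple n) → Schedule E → ℕ
makespan {m = m} E s = foldr _⊔_ 0 (map (load E s) (allFinL m))

-- All jobs have size at least 12, and together they have size 47·|E|: each ground set has n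
-- element jobs and |E| − n dummy jobs, and α and β both sum to 47 over A, B, C. Hence makespan 47
-- forces load exactly 47 on every machine, and as the only sums of job sizes equal to 47 are
-- 12 + 13 + 22 and 14 + 15 + 18, every machine gets one job of each ground set, either all element
-- jobs or all dummy jobs. Each job demands at most the capacity of its machine, while in total the
-- demands equal the capacities; so the X-job on machine e has index c_X(e), and the machines that
-- receive element jobs form a perfect matching. Conversely, given a matching F, send the element
-- job of x to its triplet in F and the dummy jobs of x bijectively to the other triplets containing x.
module Submission where

open import Defs
open import Data.Bool using (Bool; true; false)
import Data.Bool.Properties as Bool
open import Data.Empty using (⊥-elim)
open import Data.Fin using (Fin; zero; suc; punchIn; punchOut)
open import Data.Fin.Properties using (_≟_; toℕ-injective; punchIn-injective; punchInᵢ≢i; punchIn-punchOut)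
open import Data.List using (List; []; _∷_; map; filter; length; concatMap; foldr; lookup; allFin; cartesianProduct)
import Data.List.Properties as List
open import Data.List.Membership.Propositional using (_∈_; find; lose)
open import Data.List.Membership.Propositional.Properties
  using ( ∈-map⁺; ∈-map⁻; ∈-concatMap⁺; ∈-concatMap⁻; ∈-filter⁺; ∈-filter⁻; ∈-allFin; ∈-lookup; ∈-length
        ; ∈-cartesianProduct⁺)
open import Data.List.Relation.Binary.Permutation.Propositional using (_↭_; ↭-refl; ↭-sym; ↭-trans; prep; swap)
open import Data.List.Relation.Binary.Permutation.Propositional.Properties as ↭ using (↭-map-inv; ∈-resp-↭)
open import Data.List.Relation.Unary.All as All using (All; all?; []; _∷_)
import Data.List.Relation.Unary.All.Properties as All
open import Data.List.Relation.Unary.AllPairs using ([]; _∷_)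
open import Data.List.Relation.Unary.Any as Any using (here; there)
open import Data.List.Relation.Unary.Any.Properties using (lookup-index)
open import Data.List.Relation.Unary.Unique.Propositional using (Unique)
import Data.List.Relation.Unary.Unique.Propositional.Properties as Unique
open import Data.Nat using (ℕ; suc; _+_; _*_; _∸_; _⊔_; _≤_; _≤?_; z≤n)
open import Data.Nat.Properties
  using ( +-identityʳ; *-identityʳ; *-zeroʳ; *-distribʳ-+; +-mono-≤; +-mono-<-≤; +-cancelˡ-≡; <-irrefl
        ; m≤n⇒m<n∨m≡n; ≤-reflexive; ≤-trans; m≤m+n; m+n∸m≡n; m+[n∸m]≡n; suc-injective
        ; ⊔-lub; m⊔n≤o⇒m≤o; m⊔n≤o⇒n≤o; module ≤-Reasoning)
import Data.Nat.Properties as ℕ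
open import Data.Nat.ListAction using (sum)
open import Data.Nat.ListAction.Properties using (sum-++; sum-↭)
open import Data.Nat.Tactic.RingSolver using (solve-∀)
open import Data.Product using (Σ; _×_; _,_; proj₁; proj₂)
open import Data.Product.Properties using (≡-dec)
open import Data.Sum using (inj₁; inj₂)
open import Function using (_∘_)
open import Function.Bundles using (_⇔_; mk⇔)
open import Function.Definitions using (Injective)
open import Relation.Binary using (DecidableEquality)
open import Relation.Binary.PropositionalEquality
open import Relation.Nullary using (Dec; yes; no; ¬_; _→-dec_; _×-dec_)
open import Relation.Nullary.Decidable using (from-yes; from-no)
open import Relation.Unary using (Pred; Decidable)

∑ : ∀ {a} {A : Set a} → List A → (A → ℕ) → ℕ
∑ xs f = sum (map f xs)

infix 5 ∑
syntax ∑ xs (λ x → e) = ∑[ x ∈ xs ] e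

when : ∀ {p} {P : Set p} → Dec P → ℕ → ℕ
when (yes _) v = v
when (no _)  _ = 0

module _ {p} {P : Set p} where

  when-yes : (P? : Dec P) → P → ∀ v → when P? v ≡ v
  when-yes (yes _) _ v = refl
  when-yes (no ¬p) p v = ⊥-elim (¬p p)

  when-no : (P? : Dec P) → ¬ P → ∀ v → when P? v ≡ 0
  when-no (yes p) ¬p v = ⊥-elim (¬p p)
  when-no (no _)  _  v = refl

+-interchange : ∀ a b c d → a + b + (c + d) ≡ a + c + (b + d)
+-interchange = solve-∀

module _ {a} {A : Set a} where

  ∑-cong : (xs : List A) {f g : A → ℕ} → (∀ {x} → x ∈ xs → f x ≡ g x) → ∑ xs f ≡ ∑ xs g
  ∑-cong []       f≡g = refl
  ∑-cong (x ∷ xs) f≡g = cong₂ _+_ (f≡g (here refl)) (∑-cong xs (f≡g ∘ there))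

  ∑-const : (xs : List A) (c : ℕ) → ∑[ _ ∈ xs ] c ≡ length xs * c
  ∑-const []       c = refl
  ∑-const (x ∷ xs) c = cong (c +_) (∑-const xs c)

  ∑-zero : (xs : List A) {f : A → ℕ} → (∀ {x} → x ∈ xs → f x ≡ 0) → ∑ xs f ≡ 0
  ∑-zero xs f≡0 = trans (∑-cong xs f≡0) (trans (∑-const xs 0) (*-zeroʳ (length xs)))

  ∑-+ : (xs : List A) (f g : A → ℕ) → ∑[ x ∈ xs ] (f x + g x) ≡ ∑ xs f + ∑ xs g
  ∑-+ []       f g = refl
  ∑-+ (x ∷ xs) f g = trans (cong (f x + g x +_) (∑-+ xs f g)) (+-interchange (f x) (g x) (∑ xs f) (∑ xs g))

  ∑-*ʳ : (xs : List A) (f : A → ℕ) (c : ℕ) → ∑[ x ∈ xs ] (f x * c) ≡ ∑ xs f * c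
  ∑-*ʳ []       f c = refl
  ∑-*ʳ (x ∷ xs) f c = trans (cong (f x * c +_) (∑-*ʳ xs f c)) (sym (*-distribʳ-+ c (f x) (∑ xs f)))

  ∑-mono : (xs : List A) {f g : A → ℕ} → (∀ x → f x ≤ g x) → ∑ xs f ≤ ∑ xs g
  ∑-mono []       f≤g = z≤n
  ∑-mono (x ∷ xs) f≤g = +-mono-≤ (f≤g x) (∑-mono xs f≤g)

  ∑-mono-≡⇒≡ : (xs : List A) {f g : A → ℕ} → (∀ x → f x ≤ g x) → ∑ xs f ≡ ∑ xs g →
               ∀ {x} → x ∈ xs → f x ≡ g x
  ∑-mono-≡⇒≡ (y ∷ ys) {f} {g} f≤g ∑≡ x∈ with m≤n⇒m<n∨m≡n (f≤g y)
  ... | inj₁ fy<gy = ⊥-elim (<-irrefl ∑≡ (+-mono-<-≤ fy<gy (∑-mono ys f≤g)))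
  ... | inj₂ fy≡gy with x∈
  ...   | here refl  = fy≡gy
  ...   | there x∈ys = ∑-mono-≡⇒≡ ys f≤g (+-cancelˡ-≡ (f y) _ _ (trans ∑≡ (cong (_+ ∑ ys g) (sym fy≡gy)))) x∈ys

  ∑-single : {xs : List A} → Unique xs → ∀ {y} → y ∈ xs → (f : A → ℕ) → (∀ x → x ≢ y → f x ≡ 0) → ∑ xs f ≡ f y
  ∑-single {_ ∷ xs} (x∉ ∷ _) (here refl) f vanish =
    trans (cong (f _ +_) (∑-zero xs λ x∈ → vanish _ λ { refl → All.lookup x∉ x∈ refl })) (+-identityʳ _)
  ∑-single {x ∷ xs} (x∉ ∷ u) (there y∈) f vanish =
    trans (cong (_+ ∑ xs f) (vanish x (All.lookup x∉ y∈))) (∑-single u y∈ f vanish)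

  ∑-comm : ∀ {b} {B : Set b} (ys : List B) (xs : List A) (f : B → A → ℕ) →
           ∑[ y ∈ ys ] ∑[ x ∈ xs ] f y x ≡ ∑[ x ∈ xs ] ∑[ y ∈ ys ] f y x
  ∑-comm []       xs f = sym (∑-zero xs λ _ → refl)
  ∑-comm (y ∷ ys) xs f = trans (cong ((∑[ x ∈ xs ] f y x) +_) (∑-comm ys xs f)) (sym (∑-+ xs (f y) _))

  ∑-map : ∀ {b} {B : Set b} (g : B → A) (f : A → ℕ) (xs : List B) → ∑ (map g xs) f ≡ ∑[ x ∈ xs ] f (g x)
  ∑-map g f xs = cong sum (sym (List.map-∘ xs))

  ∑-concatMap : ∀ {b} {B : Set b} (g : A → List B) (h : B → ℕ) (xs : List A) →
                ∑ (concatMap g xs) h ≡ ∑[ x ∈ xs ] ∑ (g x) h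
  ∑-concatMap g h []       = refl
  ∑-concatMap g h (x ∷ xs) =
    trans (cong sum (List.map-++ h (g x) (concatMap g xs)))
          (trans (sum-++ (map h (g x)) _) (cong (∑ (g x) h +_) (∑-concatMap g h xs)))

  ∑-filter : ∀ {p} {P : Pred A p} (P? : Decidable P) (f : A → ℕ) (xs : List A) →
             ∑ (filter P? xs) f ≡ ∑[ x ∈ xs ] when (P? x) (f x)
  ∑-filter P? f []       = refl
  ∑-filter P? f (x ∷ xs) with P? x
  ... | yes _ = cong (f x +_) (∑-filter P? f xs)
  ... | no  _ = ∑-filter P? f xs

length-allFin : ∀ n → length (allFin n) ≡ n
length-allFin n = List.length-tabulate (λ i → i)

∑-allFin-const : ∀ n c → ∑[ _ ∈ allFin n ] c ≡ n * c
∑-allFin-const n c = trans (∑-const (allFin n) c) (cong (_* c) (length-allFin n))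

module _ {a} {A : Set a} {r} (g : A → Fin r) where

  fibre : Fin r → List A → List A
  fibre b = filter (λ x → g x ≟ b)

  ∑-partition : (h : A → ℕ) (xs : List A) → ∑[ b ∈ allFin r ] ∑ (fibre b xs) h ≡ ∑ xs h
  ∑-partition h xs = begin
    ∑[ b ∈ allFin r ] ∑ (fibre b xs) h                 ≡⟨ ∑-cong (allFin r) (λ {b} _ → ∑-filter (λ x → g x ≟ b) h xs) ⟩
    ∑[ b ∈ allFin r ] ∑[ x ∈ xs ] when (g x ≟ b) (h x) ≡⟨ ∑-comm (allFin r) xs _ ⟩
    ∑[ x ∈ xs ] ∑[ b ∈ allFin r ] when (g x ≟ b) (h x) ≡⟨ ∑-cong xs (λ {x} _ → own-fibre x) ⟩
    ∑ xs h                                             ∎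
    where
      open ≡-Reasoning
      own-fibre : ∀ x → ∑[ b ∈ allFin r ] when (g x ≟ b) (h x) ≡ h x
      own-fibre x = trans (∑-single (Unique.allFin⁺ r) (∈-allFin (g x)) _ (λ b b≢ → when-no (g x ≟ b) (b≢ ∘ sym) (h x)))
                          (when-yes (g x ≟ g x) refl (h x))

  ∑-fibres : (f : Fin r → ℕ) (xs : List A) → ∑[ x ∈ xs ] f (g x) ≡ ∑[ b ∈ allFin r ] length (fibre b xs) * f b
  ∑-fibres f xs = trans (sym (∑-partition (f ∘ g) xs)) (∑-cong (allFin r) λ {b} _ →
    trans (∑-cong (fibre b xs) (λ x∈ → cong f (proj₂ (∈-filter⁻ (λ x → g x ≟ b) {xs = xs} x∈))))
          (∑-const (fibre b xs) (f b)))

foldr-⊔-lub⁻ : ∀ {c} (xs : List ℕ) → foldr _⊔_ 0 xs ≤ c → All (_≤ c) xs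
foldr-⊔-lub⁻ = List.foldr-forcesᵇ (λ x y x⊔y≤c → m⊔n≤o⇒m≤o x y x⊔y≤c , m⊔n≤o⇒n≤o x y x⊔y≤c) 0

foldr-⊔-lub : ∀ {c} {xs : List ℕ} → All (_≤ c) xs → foldr _⊔_ 0 xs ≤ c
foldr-⊔-lub = List.foldr-preservesᵇ ⊔-lub z≤n

module _ {a} {A : Set a} where

  insertions : A → List A → List (List A)
  insertions x []       = (x ∷ []) ∷ []
  insertions x (y ∷ ys) = (x ∷ y ∷ ys) ∷ map (y ∷_) (insertions x ys)

  permutations : List A → List (List A)
  permutations []       = [] ∷ []
  permutations (x ∷ xs) = concatMap (insertions x) (permutations xs)

  ∈-insertions⇒↭ : ∀ {x ys zs} → zs ∈ insertions x ys → zs ↭ x ∷ ys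
  ∈-insertions⇒↭ {ys = []}     (here refl) = ↭-refl
  ∈-insertions⇒↭ {ys = y ∷ ys} (here refl) = ↭-refl
  ∈-insertions⇒↭ {ys = y ∷ ys} (there zs∈) with ∈-map⁻ (y ∷_) zs∈
  ... | ws , ws∈ , refl = ↭-trans (prep y (∈-insertions⇒↭ ws∈)) (swap y _ ↭-refl)

  ∈-permutations⇒↭ : ∀ {xs ys} → ys ∈ permutations xs → ys ↭ xs
  ∈-permutations⇒↭ {[]}     (here refl) = ↭-refl
  ∈-permutations⇒↭ {x ∷ xs} ys∈ with find (∈-concatMap⁻ (insertions x) {xs = permutations xs} ys∈)
  ... | ws , ws∈ , ys∈′ = ↭-trans (∈-insertions⇒↭ ys∈′) (prep x (∈-permutations⇒↭ ws∈))

  lookup-injective : {xs : List A} → Unique xs → ∀ {i j} → lookup xs i ≡ lookup xs j → i ≡ j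
  lookup-injective {_ ∷ _} _        {zero}  {zero}  _  = refl
  lookup-injective {_ ∷ _} (x∉ ∷ _) {zero}  {suc j} eq = ⊥-elim (All.lookup x∉ (∈-lookup j) eq)
  lookup-injective {_ ∷ _} (x∉ ∷ _) {suc i} {zero}  eq = ⊥-elim (All.lookup x∉ (∈-lookup i) (sym eq))
  lookup-injective {_ ∷ _} (_ ∷ u)  {suc i} {suc j} eq = cong suc (lookup-injective u eq)

position : ∀ {d} → Fin d → Kind d → Fin d
-- The first clause does not split on d, so that position p elemJob reduces to p for every d.
position         p elemJob      = p
position {suc d} p (dummyJob t) = punchIn p t

position-injective : ∀ {d} (p : Fin d) {κ κ′} → position p κ ≡ position p κ′ → κ ≡ κ′
position-injective {suc d} p {elemJob}    {elemJob}     eq = refl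
position-injective {suc d} p {elemJob}    {dummyJob t′} eq = ⊥-elim (punchInᵢ≢i p t′ (sym eq))
position-injective {suc d} p {dummyJob t} {elemJob}     eq = ⊥-elim (punchInᵢ≢i p t eq)
position-injective {suc d} p {dummyJob t} {dummyJob t′} eq = cong dummyJob (punchIn-injective p t t′ eq)

position-surjective : ∀ {d} (p q : Fin d) → Σ (Kind d) λ κ → position p κ ≡ q
position-surjective {suc d} p q with p ≟ q
... | yes refl = elemJob , refl
... | no p≢q   = dummyJob (punchOut p≢q) , punchIn-punchOut p≢q

module Placement {a} {A : Set a} {xs : List A} (unique : Unique xs) {x₀ : A} (x₀∈ : x₀ ∈ xs) where

  place : Kind (length xs) → A
  place κ = lookup xs (position (Any.index x₀∈) κ)

  place-elemJob : place elemJob ≡ x₀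
  place-elemJob = sym (lookup-index x₀∈)

  place-∈ : ∀ κ → place κ ∈ xs
  place-∈ κ = ∈-lookup _

  place-injective : ∀ {κ κ′} → place κ ≡ place κ′ → κ ≡ κ′
  place-injective eq = position-injective (Any.index x₀∈) (lookup-injective unique eq)

  place-surjective : ∀ {x} → x ∈ xs → Σ (Kind (length xs)) λ κ → place κ ≡ x
  place-surjective x∈ with position-surjective (Any.index x₀∈) (Any.index x∈)
  ... | κ , κ↦ = κ , trans (cong (lookup xs) κ↦) (sym (lookup-index x∈))

_≟ᴿ_ : DecidableEquality Res
rA ≟ᴿ rA = yes refl
rA ≟ᴿ rB = no λ ()
rA ≟ᴿ rC = no λ ()
rB ≟ᴿ rA = no λ ()
rB ≟ᴿ rB = yes refl
rB ≟ᴿ rC = no λ ()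
rC ≟ᴿ rA = no λ ()
rC ≟ᴿ rB = no λ ()
rC ≟ᴿ rC = yes refl

∈-allRes : ∀ X → X ∈ allRes
∈-allRes rA = here refl
∈-allRes rB = there (here refl)
∈-allRes rC = there (there (here refl))

unique-allRes : Unique allRes
unique-allRes = ((λ ()) ∷ (λ ()) ∷ []) ∷ ((λ ()) ∷ []) ∷ [] ∷ []

sameRes-when : ∀ Y X v → sameRes Y X v ≡ when (Y ≟ᴿ X) v
sameRes-when rA rA v = refl
sameRes-when rA rB v = refl
sameRes-when rA rC v = refl
sameRes-when rB rA v = refl
sameRes-when rB rB v = refl
sameRes-when rB rC v = refl
sameRes-when rC rA v = refl
sameRes-when rC rB v = refl
sameRes-when rC rC v = refl

sameRes-diag : ∀ X v → sameRes X X v ≡ v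
sameRes-diag X v = trans (sameRes-when X X v) (when-yes (X ≟ᴿ X) refl v)

Tag : Set
Tag = Res × Bool

weight : Tag → ℕ
weight (X , true)  = α X
weight (X , false) = β X

allTags : List Tag
allTags = cartesianProduct allRes (true ∷ false ∷ [])

∈-allTags : ∀ t → t ∈ allTags
∈-allTags (X , true)  = ∈-cartesianProduct⁺ {xs = allRes} {ys = true ∷ false ∷ []} (∈-allRes X) (here refl)
∈-allTags (X , false) = ∈-cartesianProduct⁺ {xs = allRes} {ys = true ∷ false ∷ []} (∈-allRes X) (there (here refl))

triadTags : Bool → List Tag
triadTags b = (rA , b) ∷ (rB , b) ∷ (rC , b) ∷ []

∑-weight-triadTags : ∀ b → ∑ (triadTags b) weight ≡ 47
∑-weight-triadTags true  = refl
∑-weight-triadTags false = refl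

weight-bounds : ∀ t → 12 ≤ weight t × weight t ≤ 22
weight-bounds t = All.lookup (from-yes (all? (λ t → 12 ≤? weight t ×-dec weight t ≤? 22) allTags)) (∈-allTags t)

Weight47⇒Triad : Tag → Tag → Tag → Set
Weight47⇒Triad s t u = ∑ (s ∷ t ∷ u ∷ []) weight ≡ 47 → s ∷ t ∷ u ∷ [] ∈ permutations (triadTags (proj₂ s))

-- Decided by evaluating all 6³ triples of tags; abstract, so that the evaluation is never redone.
abstract
  weight47⇒triad₃ : All (λ s → All (λ t → All (Weight47⇒Triad s t) allTags) allTags) allTags
  weight47⇒triad₃ = from-yes (all? (λ s → all? (λ t → all? (λ u →
      (∑ (s ∷ t ∷ u ∷ []) weight ℕ.≟ 47) →-dec (s ∷ t ∷ u ∷ [] ∈?ᴸ permutations (triadTags (proj₂ s))))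
    allTags) allTags) allTags)
    where
      _≟ᵀ_ : DecidableEquality Tag
      _≟ᵀ_ = ≡-dec _≟ᴿ_ Bool._≟_
      open import Data.List.Membership.DecPropositional (List.≡-dec _≟ᵀ_) using () renaming (_∈?_ to _∈?ᴸ_)

weight47⇒triad : (ts : List Tag) → ∑ ts weight ≡ 47 → Σ Bool λ b → ts ↭ triadTags b
weight47⇒triad []               ()
weight47⇒triad (s ∷ [])         total =
  ⊥-elim (from-no (47 ≤? 22) (subst (_≤ 22) total (∑-mono (s ∷ []) (proj₂ ∘ weight-bounds))))
weight47⇒triad (s ∷ t ∷ [])     total =
  ⊥-elim (from-no (47 ≤? 44) (subst (_≤ 44) total (∑-mono (s ∷ t ∷ []) (proj₂ ∘ weight-bounds))))
weight47⇒triad (s ∷ t ∷ u ∷ []) total =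
  proj₂ s , ∈-permutations⇒↭ (All.lookup (All.lookup (All.lookup weight47⇒triad₃ (∈-allTags s)) (∈-allTags t)) (∈-allTags u) total)
weight47⇒triad ts@(_ ∷ _ ∷ _ ∷ _ ∷ ts′) total =
  ⊥-elim (from-no (48 ≤? 47) (subst (48 ≤_) total (≤-trans (m≤m+n 48 (∑[ _ ∈ ts′ ] 12)) (∑-mono ts (proj₁ ∘ weight-bounds)))))

∈-allKind : ∀ {d} (κ : Kind d) → κ ∈ allKind d
∈-allKind elemJob      = here refl
∈-allKind (dummyJob t) = there (∈-map⁺ dummyJob (∈-allFin t))

unique-allKind : ∀ d → Unique (allKind d)
unique-allKind d = All.map⁺ (All.universal (λ _ ()) (allFin (d ∸ 1))) ∷ Unique.map⁺ (λ { refl → refl }) (Unique.allFin⁺ (d ∸ 1))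

length-allKind : ∀ d → length (allKind d) ≡ suc (d ∸ 1)
length-allKind d = cong suc (trans (List.length-map (dummyJob {d}) (allFin (d ∸ 1))) (length-allFin (d ∸ 1)))

idx-injective : ∀ {n} {i j : Fin n} → idx i ≡ idx j → i ≡ j
idx-injective = toℕ-injective ∘ suc-injective

sizes-total : ∀ n k → n * 12 + k * 14 + (n * 13 + k * 15 + (n * 22 + k * 18 + 0)) ≡ (n + k) * 47
sizes-total = solve-∀

module _ {n m : ℕ} (E : Fin m → Triple n) where

  JobOf : Res → Set
  JobOf X = Σ (Fin n) λ i → Kind (deg E X i)

  isElement : ∀ {d} → Kind d → Bool
  isElement elemJob      = true
  isElement (dummyJob _) = false

  isElement-true : ∀ {d} {κ : Kind d} → isElement κ ≡ true → κ ≡ elemJob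
  isElement-true {κ = elemJob} refl = refl

  elemJob-unique : ∀ X {i} (x : JobOf X) → proj₁ x ≡ i → isElement (proj₂ x) ≡ true → x ≡ (i , elemJob)
  elemJob-unique X (i , κ) refl isElem = cong (i ,_) (isElement-true isElem)

  tag : Job E → Tag
  tag (X , _ , κ) = X , isElement κ

  size-tag : ∀ j → size E j ≡ weight (tag j)
  size-tag (X , _ , elemJob)    = refl
  size-tag (X , _ , dummyJob _) = refl

  record Triad (l : List (Job E)) : Set where
    field
      flag        : Bool
      slot        : (X : Res) → JobOf X
      slot-flag   : ∀ X → isElement (proj₂ (slot X)) ≡ flag
      arrangement : l ↭ (rA , slot rA) ∷ (rB , slot rB) ∷ (rC , slot rC) ∷ []

    slot-∈ : ∀ X → (X , slot X) ∈ l
    slot-∈ X = ∈-resp-↭ (↭-sym arrangement) (listed X)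
      where
        listed : ∀ X → (X , slot X) ∈ (rA , slot rA) ∷ (rB , slot rB) ∷ (rC , slot rC) ∷ []
        listed rA = here refl
        listed rB = there (here refl)
        listed rC = there (there (here refl))

    ∈⇒slot : ∀ {X x} → (X , x) ∈ l → x ≡ slot X
    ∈⇒slot x∈ with ∈-resp-↭ arrangement x∈
    ... | here refl                 = refl
    ... | there (here refl)         = refl
    ... | there (there (here refl)) = refl

    ∑-demand≡slot : ∀ X → ∑[ j ∈ l ] demand E j X ≡ idx (proj₁ (slot X))
    ∑-demand≡slot X = trans (sum-↭ (↭.map⁺ (λ j → demand E j X) arrangement)) (listed X)
      where
        listed : ∀ X → ∑[ j ∈ (rA , slot rA) ∷ (rB , slot rB) ∷ (rC , slot rC) ∷ [] ] demand E j X ≡ idx (proj₁ (slot X))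
        listed rA = +-identityʳ _
        listed rB = +-identityʳ _
        listed rC = +-identityʳ _

  Triad-resp-↭ : ∀ {l l′} → l ↭ l′ → Triad l′ → Triad l
  Triad-resp-↭ l↭l′ t = record { Triad t ; arrangement = ↭-trans l↭l′ (Triad.arrangement t) }

  -- Only the two consistent flag patterns are listed: the equation with triadTags b refutes the
  -- others, as well as the lists of length other than 3 in size47⇒triad below.
  triad-of-tags : ∀ {b} j₁ j₂ j₃ → triadTags b ≡ map tag (j₁ ∷ j₂ ∷ j₃ ∷ []) → Triad (j₁ ∷ j₂ ∷ j₃ ∷ [])
  triad-of-tags (_ , a , elemJob) (_ , b , elemJob) (_ , c , elemJob) refl = record
    { flag = true ; slot = λ { rA → a , elemJob ; rB → b , elemJob ; rC → c , elemJob }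
    ; slot-flag = λ { rA → refl ; rB → refl ; rC → refl } ; arrangement = ↭-refl }
  triad-of-tags (_ , a , dummyJob s) (_ , b , dummyJob t) (_ , c , dummyJob u) refl = record
    { flag = false ; slot = λ { rA → a , dummyJob s ; rB → b , dummyJob t ; rC → c , dummyJob u }
    ; slot-flag = λ { rA → refl ; rB → refl ; rC → refl } ; arrangement = ↭-refl }

  size47⇒triad : (l : List (Job E)) → ∑ l (size E) ≡ 47 → Triad l
  size47⇒triad l total with weight47⇒triad (map tag l) (trans (∑-map tag weight l) (trans (∑-cong l (λ {j} _ → sym (size-tag j))) total))
  ... | b , tags↭ with ↭-map-inv tag tags↭
  ... | j₁ ∷ j₂ ∷ j₃ ∷ [] , tags≡ , l↭ = Triad-resp-↭ l↭ (triad-of-tags j₁ j₂ j₃ tags≡)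

  jobsOfElement : (X : Res) → Fin n → List (Job E)
  jobsOfElement X i = map (λ κ → X , i , κ) (allKind (deg E X i))

  jobsOfResource : Res → List (Job E)
  jobsOfResource X = concatMap (jobsOfElement X) (allFin n)

  ∈-allJobs : (j : Job E) → j ∈ allJobs E
  ∈-allJobs (X , i , κ) = ∈-concatMap⁺ jobsOfResource (lose (∈-allRes X)
    (∈-concatMap⁺ (jobsOfElement X) (lose (∈-allFin i) (∈-map⁺ (λ κ → X , i , κ) (∈-allKind κ)))))

  ∑-allJobs : (h : Job E → ℕ) →
    ∑ (allJobs E) h ≡ ∑[ X ∈ allRes ] ∑[ i ∈ allFin n ] ∑[ κ ∈ allKind (deg E X i) ] h (X , i , κ)
  ∑-allJobs h = trans (∑-concatMap jobsOfResource h allRes) (∑-cong allRes λ {X} _ →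
    trans (∑-concatMap (jobsOfElement X) h (allFin n)) (∑-cong (allFin n) λ {i} _ → ∑-map (λ κ → X , i , κ) h (allKind (deg E X i))))

  ∑-allKind-size : ∀ X i → ∑[ κ ∈ allKind (deg E X i) ] size E (X , i , κ) ≡ α X + (deg E X i ∸ 1) * β X
  ∑-allKind-size X i = cong (α X +_)
    (trans (∑-map dummyJob (λ κ → size E (X , i , κ)) (allFin (deg E X i ∸ 1))) (∑-allFin-const (deg E X i ∸ 1) (β X)))

  ∑-deg : ∀ X → ∑[ i ∈ allFin n ] deg E X i ≡ m
  ∑-deg X = begin
    ∑[ i ∈ allFin n ] deg E X i      ≡⟨ ∑-cong (allFin n) (λ _ → sym (*-identityʳ _)) ⟩
    ∑[ i ∈ allFin n ] deg E X i * 1  ≡⟨ sym (∑-fibres (coord X ∘ E) (λ _ → 1) (allFin m)) ⟩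
    ∑[ k ∈ allFin m ] 1              ≡⟨ ∑-allFin-const m 1 ⟩
    m * 1                            ≡⟨ *-identityʳ m ⟩
    m                                ∎
    where open ≡-Reasoning

  ∑-capacity : ∀ X → ∑[ e ∈ allFin m ] capacity E e X ≡ ∑[ i ∈ allFin n ] deg E X i * idx i
  ∑-capacity X = ∑-fibres (coord X ∘ E) idx (allFin m)

  module _ (covered : (X : Res) (i : Fin n) → Σ (Fin m) λ k → coord X (E k) ≡ i) where

    suc-pred-deg : ∀ X i → suc (deg E X i ∸ 1) ≡ deg E X i
    suc-pred-deg X i with covered X i
    ... | k , refl = m+[n∸m]≡n (∈-length (∈-filter⁺ (λ k′ → coord X (E k′) ≟ coord X (E k)) {xs = allFin m} (∈-allFin k) refl))

    n+∑dummies : ∀ X → n + (∑[ i ∈ allFin n ] (deg E X i ∸ 1)) ≡ m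
    n+∑dummies X = begin
      n + (∑[ i ∈ allFin n ] (deg E X i ∸ 1))
        ≡⟨ cong (_+ (∑[ i ∈ allFin n ] (deg E X i ∸ 1))) (sym (trans (∑-allFin-const n 1) (*-identityʳ n))) ⟩
      (∑[ i ∈ allFin n ] 1) + (∑[ i ∈ allFin n ] (deg E X i ∸ 1))
        ≡⟨ sym (∑-+ (allFin n) (λ _ → 1) _) ⟩
      ∑[ i ∈ allFin n ] suc (deg E X i ∸ 1)
        ≡⟨ ∑-cong (allFin n) (λ {i} _ → suc-pred-deg X i) ⟩
      ∑[ i ∈ allFin n ] deg E X i
        ≡⟨ ∑-deg X ⟩
      m ∎
      where open ≡-Reasoning

    ∑-size-resource : ∀ X → ∑[ i ∈ allFin n ] ∑[ κ ∈ allKind (deg E X i) ] size E (X , i , κ) ≡ n * α X + (m ∸ n) * β X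
    ∑-size-resource X = begin
      ∑[ i ∈ allFin n ] ∑[ κ ∈ allKind (deg E X i) ] size E (X , i , κ)
        ≡⟨ ∑-cong (allFin n) (λ {i} _ → ∑-allKind-size X i) ⟩
      ∑[ i ∈ allFin n ] (α X + (deg E X i ∸ 1) * β X)
        ≡⟨ ∑-+ (allFin n) (λ _ → α X) _ ⟩
      (∑[ i ∈ allFin n ] α X) + (∑[ i ∈ allFin n ] ((deg E X i ∸ 1) * β X))
        ≡⟨ cong₂ _+_ (∑-allFin-const n (α X)) (∑-*ʳ (allFin n) _ (β X)) ⟩
      n * α X + (∑[ i ∈ allFin n ] (deg E X i ∸ 1)) * β X
        ≡⟨ cong (λ d → n * α X + d * β X) (trans (sym (m+n∸m≡n n _)) (cong (_∸ n) (n+∑dummies X))) ⟩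
      n * α X + (m ∸ n) * β X ∎
      where open ≡-Reasoning

    ∑-size-allJobs : ∑ (allJobs E) (size E) ≡ m * 47
    ∑-size-allJobs = begin
      ∑ (allJobs E) (size E)
        ≡⟨ ∑-allJobs (size E) ⟩
      ∑[ X ∈ allRes ] ∑[ i ∈ allFin n ] ∑[ κ ∈ allKind (deg E X i) ] size E (X , i , κ)
        ≡⟨ ∑-cong allRes (λ {X} _ → ∑-size-resource X) ⟩
      ∑[ X ∈ allRes ] (n * α X + (m ∸ n) * β X)
        ≡⟨ sizes-total n (m ∸ n) ⟩
      (n + (m ∸ n)) * 47
        ≡⟨ cong (_* 47) (m+[n∸m]≡n (subst (n ≤_) (n+∑dummies rA) (m≤m+n n _))) ⟩
      m * 47 ∎
      where open ≡-Reasoning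

    ∑-demand≡∑-capacity : ∀ X → ∑[ j ∈ allJobs E ] demand E j X ≡ ∑[ e ∈ allFin m ] capacity E e X
    ∑-demand≡∑-capacity X = begin
      ∑[ j ∈ allJobs E ] demand E j X
        ≡⟨ ∑-allJobs (λ j → demand E j X) ⟩
      ∑[ Y ∈ allRes ] ∑[ i ∈ allFin n ] ∑[ κ ∈ allKind (deg E Y i) ] sameRes Y X (idx i)
        ≡⟨ ∑-single unique-allRes (∈-allRes X) _ (λ Y Y≢X → ∑-zero (allFin n) λ {i} _ → ∑-zero (allKind (deg E Y i)) λ _ →
             trans (sameRes-when Y X (idx i)) (when-no (Y ≟ᴿ X) Y≢X (idx i))) ⟩
      ∑[ i ∈ allFin n ] ∑[ κ ∈ allKind (deg E X i) ] sameRes X X (idx i)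
        ≡⟨ ∑-cong (allFin n) (λ {i} _ → trans (∑-cong (allKind (deg E X i)) (λ _ → sameRes-diag X (idx i)))
                                              (∑-const (allKind (deg E X i)) (idx i))) ⟩
      ∑[ i ∈ allFin n ] length (allKind (deg E X i)) * idx i
        ≡⟨ ∑-cong (allFin n) (λ {i} _ → cong (_* idx i) (trans (length-allKind (deg E X i)) (suc-pred-deg X i))) ⟩
      ∑[ i ∈ allFin n ] deg E X i * idx i
        ≡⟨ sym (∑-capacity X) ⟩
      ∑[ e ∈ allFin m ] capacity E e X ∎
      where open ≡-Reasoning

-- From a schedule of makespan 47 to a perfect matching

module Backward {n m : ℕ} (E : Fin m → Triple n)
                (covered : (X : Res) (i : Fin n) → Σ (Fin m) λ k → coord X (E k) ≡ i)
                (S : Schedule E) (bounded : makespan E S ≤ 47) where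

  σ : Job E → Fin m
  σ = proj₁ S

  jobsOn : Fin m → List (Job E)
  jobsOn e = fibre σ e (allJobs E)

  load≡47 : ∀ e → load E S e ≡ 47
  load≡47 e = ∑-mono-≡⇒≡ (allFin m) (All.lookup (All.map⁻ (foldr-⊔-lub⁻ _ bounded)) ∘ ∈-allFin) total (∈-allFin e)
    where
      open ≡-Reasoning
      total : ∑[ e ∈ allFin m ] load E S e ≡ ∑[ e ∈ allFin m ] 47
      total = begin
        ∑[ e ∈ allFin m ] load E S e ≡⟨ ∑-partition σ (size E) (allJobs E) ⟩
        ∑ (allJobs E) (size E)       ≡⟨ ∑-size-allJobs E covered ⟩
        m * 47                       ≡⟨ sym (∑-allFin-const m 47) ⟩
        ∑[ e ∈ allFin m ] 47         ∎

  machine : ∀ e → Triad E (jobsOn e)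
  machine e = size47⇒triad E (jobsOn e) (load≡47 e)

  module M e = Triad (machine e)

  slot-on : ∀ e X → σ (X , M.slot e X) ≡ e
  slot-on e X = proj₂ (∈-filter⁻ (λ j → σ j ≟ e) {xs = allJobs E} (M.slot-∈ e X))

  job-slot : ∀ X (x : JobOf E X) → x ≡ M.slot (σ (X , x)) X
  job-slot X x = M.∈⇒slot _ (∈-filter⁺ (λ j → σ j ≟ σ (X , x)) (∈-allJobs E (X , x)) refl)

  ∑-demand≤capacity : ∀ X e → ∑[ j ∈ jobsOn e ] demand E j X ≤ capacity E e X
  ∑-demand≤capacity X e = begin
    ∑[ j ∈ jobsOn e ] demand E j X    ≡⟨ M.∑-demand≡slot e X ⟩
    idx (proj₁ (M.slot e X))          ≡⟨ sym (sameRes-diag X _) ⟩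
    demand E (X , M.slot e X) X       ≤⟨ proj₂ S (X , M.slot e X) X ⟩
    capacity E (σ (X , M.slot e X)) X ≡⟨ cong (λ k → capacity E k X) (slot-on e X) ⟩
    capacity E e X                    ∎
    where open ≤-Reasoning

  slot-index : ∀ e X → proj₁ (M.slot e X) ≡ coord X (E e)
  slot-index e X = idx-injective (trans (sym (M.∑-demand≡slot e X))
    (∑-mono-≡⇒≡ (allFin m) (∑-demand≤capacity X)
      (trans (∑-partition σ _ (allJobs E)) (∑-demand≡∑-capacity E covered X)) (∈-allFin e)))

  Matched : Fin m → Set
  Matched k = M.flag k ≡ true

  element-job-matched : ∀ X i → Matched (σ (X , i , elemJob))
  element-job-matched X i = trans (sym (M.slot-flag _ X)) (cong (isElement E ∘ proj₂) (sym (job-slot X (i , elemJob))))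

  element-job-coord : ∀ X i → coord X (E (σ (X , i , elemJob))) ≡ i
  element-job-coord X i = trans (sym (slot-index _ X)) (cong proj₁ (sym (job-slot X (i , elemJob))))

  matched⇒element-job : ∀ {k} X → Matched k → σ (X , coord X (E k) , elemJob) ≡ k
  matched⇒element-job {k} X matched = trans (cong (λ x → σ (X , x)) (sym slot≡)) (slot-on k X)
    where
      slot≡ : M.slot k X ≡ (coord X (E k) , elemJob)
      slot≡ = elemJob-unique E X (M.slot k X) (slot-index k X) (trans (M.slot-flag k X) matched)

  perfect-matching : HasPerfectMatching E
  perfect-matching = Matched , λ X i →
    (σ (X , i , elemJob) , element-job-matched X i , element-job-coord X i) ,
    λ k k′ mk mk′ k∋i k′∋i → trans (sym (matched⇒element-job X mk))
      (trans (cong (λ c → σ (X , c , elemJob)) (trans k∋i (sym k′∋i))) (matched⇒element-job X mk′))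

-- From a perfect matching to a schedule of makespan 47

module Forward {n m : ℕ} (E : Fin m → Triple n) (PM : HasPerfectMatching E) where

  Matched : Fin m → Set
  Matched = proj₁ PM

  partner : Res → Fin n → Fin m
  partner X i = proj₁ (proj₁ (proj₂ PM X i))

  partner-matched : ∀ X i → Matched (partner X i)
  partner-matched X i = proj₁ (proj₂ (proj₁ (proj₂ PM X i)))

  partner-coord : ∀ X i → coord X (E (partner X i)) ≡ i
  partner-coord X i = proj₂ (proj₂ (proj₁ (proj₂ PM X i)))

  matched⇒partner : ∀ X {k} → Matched k → partner X (coord X (E k)) ≡ k
  matched⇒partner X {k} matched =
    proj₂ (proj₂ PM X (coord X (E k))) _ k (partner-matched X _) matched (partner-coord X _) refl

  module P X i = Placement (Unique.filter⁺ (λ k → coord X (E k) ≟ i) (Unique.allFin⁺ m))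
                           (∈-filter⁺ (λ k → coord X (E k) ≟ i) (∈-allFin (partner X i)) (partner-coord X i))

  σ : Job E → Fin m
  σ (X , i , κ) = P.place X i κ

  σ-coord : ∀ X i κ → coord X (E (σ (X , i , κ))) ≡ i
  σ-coord X i κ = proj₂ (∈-filter⁻ (λ k → coord X (E k) ≟ i) {xs = allFin m} (P.place-∈ X i κ))

  eligible : (j : Job E) → Eligible E j (σ j)
  eligible (X , i , κ) Y rewrite sameRes-when X Y (idx i) with X ≟ᴿ Y
  ... | yes refl = ≤-reflexive (cong idx (sym (σ-coord X i κ)))
  ... | no _     = z≤n

  schedule : Schedule E
  schedule = σ , eligible

  resident : ∀ e X → Kind (deg E X (coord X (E e)))
  resident e X = proj₁ (P.place-surjective X _ (∈-filter⁺ (λ k → coord X (E k) ≟ coord X (E e)) (∈-allFin e) refl))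

  resident-on : ∀ e X → σ (X , coord X (E e) , resident e X) ≡ e
  resident-on e X = proj₂ (P.place-surjective X _ (∈-filter⁺ (λ k → coord X (E k) ≟ coord X (E e)) (∈-allFin e) refl))

  ∑-on≡resident : ∀ e X → ∑[ i ∈ allFin n ] ∑[ κ ∈ allKind (deg E X i) ] when (σ (X , i , κ) ≟ e) (size E (X , i , κ))
                          ≡ size E (X , coord X (E e) , resident e X)
  ∑-on≡resident e X = begin
    ∑[ i ∈ allFin n ] ∑[ κ ∈ allKind (deg E X i) ] when (σ (X , i , κ) ≟ e) (size E (X , i , κ))
      ≡⟨ ∑-single (Unique.allFin⁺ n) (∈-allFin c) _ (λ i i≢c → ∑-zero (allKind (deg E X i)) λ {κ} _ →
           when-no (σ (X , i , κ) ≟ e) (λ on-e → i≢c (trans (sym (σ-coord X i κ)) (cong (coord X ∘ E) on-e))) _) ⟩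
    ∑[ κ ∈ allKind (deg E X c) ] when (σ (X , c , κ) ≟ e) (size E (X , c , κ))
      ≡⟨ ∑-single (unique-allKind _) (∈-allKind (resident e X)) _ (λ κ κ≢ → when-no (σ (X , c , κ) ≟ e)
           (λ on-e → κ≢ (P.place-injective X c (trans on-e (sym (resident-on e X))))) _) ⟩
    when (σ (X , c , resident e X) ≟ e) (size E (X , c , resident e X))
      ≡⟨ when-yes (σ (X , c , resident e X) ≟ e) (resident-on e X) _ ⟩
    size E (X , c , resident e X) ∎
    where
      open ≡-Reasoning
      c : Fin n
      c = coord X (E e)

  resident-element⇒matched : ∀ e X → isElement E (resident e X) ≡ true → Matched e
  resident-element⇒matched e X isElem = subst Matched partner≡e (partner-matched X _)
    where
      partner≡e : partner X (coord X (E e)) ≡ e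
      partner≡e = trans (sym (P.place-elemJob X _)) (trans (cong (P.place X _) (sym (isElement-true E isElem))) (resident-on e X))

  matched⇒resident-element : ∀ e X → Matched e → isElement E (resident e X) ≡ true
  matched⇒resident-element e X matched =
    cong (isElement E) (P.place-injective X _ (trans (resident-on e X) (sym (trans (P.place-elemJob X _) (matched⇒partner X matched)))))

  resident-flag : ∀ e X → isElement E (resident e X) ≡ isElement E (resident e rA)
  resident-flag e X = Bool.⇔→≡ (mk⇔ (matched⇒resident-element e rA ∘ resident-element⇒matched e X)
                                   (matched⇒resident-element e X ∘ resident-element⇒matched e rA))

  load≡47 : ∀ e → load E schedule e ≡ 47
  load≡47 e = begin
    load E schedule e
      ≡⟨ ∑-filter (λ j → σ j ≟ e) (size E) (allJobs E) ⟩
    ∑[ j ∈ allJobs E ] when (σ j ≟ e) (size E j)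
      ≡⟨ trans (∑-allJobs E _) (∑-cong allRes λ {X} _ → ∑-on≡resident e X) ⟩
    ∑[ X ∈ allRes ] size E (X , coord X (E e) , resident e X)
      ≡⟨ ∑-cong allRes (λ {X} _ → trans (size-tag E (X , coord X (E e) , resident e X))
                                        (cong (λ b → weight (X , b)) (resident-flag e X))) ⟩
    ∑ (triadTags (isElement E (resident e rA))) weight
      ≡⟨ ∑-weight-triadTags (isElement E (resident e rA)) ⟩
    47 ∎
    where open ≡-Reasoning

  makespan≤47 : makespan E schedule ≤ 47
  makespan≤47 = foldr-⊔-lub (All.map⁺ (All.universal (≤-reflexive ∘ load≡47) (allFin m)))

mainTheorem9 : (n m : ℕ) (E : Fin m → Triple n) →
    Injective _≡_ _≡_ E →
    ((X : Res) (i : Fin n) → Σ (Fin m) λ k → coord X (E k) ≡ i) →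
    HasPerfectMatching E ⇔ (Σ (Schedule E) λ s → makespan E s ≤ 47)
mainTheorem9 n m E _ covered = mk⇔
  (λ PM → Forward.schedule E PM , Forward.makespan≤47 E PM)
  (λ (S , bounded) → Backward.perfect-matching E covered S bounded)
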